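{- Every graph with diameter three has a terminal set.
   Context: All graphs are simple and undirected. A set $S \subseteq V(G)$ is in general position if no shortest path of $G$ contains three vertices of $S$. A terminal set of $G$ is a general position set $S$ that is maximal under inclusion and such that for every vertex $u \in V(G)\setminus S$ there is a shortest path of $G$ with $u$ as an endpoint that contains at least two vertices of $S$. -}

module Defs where

open import Data.Nat using (ℕ; zero; suc; _≤_)
open import Data.Fin using (Fin)
open import Data.Bool using (Bool; true; false)
open import Data.List using (List; []; _∷_)
open import Data.List.Membership.Propositional using () renaming (_∈_ to _∈ˡ_)
open import Data.Fin.Subset using (Subset; _∈_; _∉_; _⊆_)
open import Data.Product using (Σ; _×_; ∃; ∃-syntax; _,_)
open import Data.Sum using (_⊎_)
open import Relation.Nullary using (¬_)
open import Relation.Binary.PropositionalEquality using (_≡_; _≢_)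

record Graph (n : ℕ) : Set where
  field
    adj    : Fin n → Fin n → Bool
    sym    : ∀ u v → adj u v ≡ adj v u
    irrefl : ∀ u → adj u u ≡ false
open Graph public

module _ {n : ℕ} (G : Graph n) where

  data Walk : Fin n → Fin n → ℕ → Set where
    nil  : ∀ {u} → Walk u u 0
    cons : ∀ {u w v k} → adj G u w ≡ true → Walk w v k → Walk u v (suc k)

  verts : ∀ {u v k} → Walk u v k → List (Fin n)
  verts {u} nil        = u ∷ []
  verts {u} (cons _ p) = u ∷ verts p

  -- a shortest u,v-path: a u,v-walk whose length is minimum among all u,v-walks
  -- (such a walk is necessarily a path)
  IsShortest : ∀ {u v k} → Walk u v k → Set
  IsShortest {u} {v} {k} _ = ∀ k' → Walk u v k' → k ≤ k'

  Dist : Fin n → Fin n → ℕ → Set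
  Dist u v k = Walk u v k × (∀ k' → Walk u v k' → k ≤ k')

  HasDiameter : ℕ → Set
  HasDiameter d = (∀ u v → ∃[ k ] (k ≤ d × Walk u v k)) × (∃[ u ] ∃[ v ] Dist u v d)

  Contains3 : Subset n → ∀ {u v k} → Walk u v k → Set
  Contains3 S p = ∃[ x ] ∃[ y ] ∃[ z ]
    (x ≢ y × x ≢ z × y ≢ z × x ∈ S × y ∈ S × z ∈ S
     × x ∈ˡ verts p × y ∈ˡ verts p × z ∈ˡ verts p)

  Contains2 : Subset n → ∀ {u v k} → Walk u v k → Set
  Contains2 S p = ∃[ x ] ∃[ y ] (x ≢ y × x ∈ S × y ∈ S × x ∈ˡ verts p × y ∈ˡ verts p)

  GeneralPosition : Subset n → Set
  GeneralPosition S = ∀ u v k (p : Walk u v k) → IsShortest p → ¬ Contains3 S p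

  MaximalGP : Subset n → Set
  MaximalGP S = GeneralPosition S × (∀ T → GeneralPosition T → S ⊆ T → T ⊆ S)

  IsTerminal : Subset n → Set
  IsTerminal S = MaximalGP S ×
    (∀ u → u ∉ S → ∃[ v ] ∃[ k ]
       ((Σ (Walk u v k) λ p → IsShortest p × Contains2 S p)
        ⊎ (Σ (Walk v u k) λ p → IsShortest p × Contains2 S p)))

{-# OPTIONS --safe #-}
-- Graph distance turns G into a metric space of diameter 3, and a shortest path through
-- three vertices of S puts one of them metrically between the other two.  Call w covered by S
-- when some x ≠ y in S satisfy d(w,y) = d(w,x) + d(x,y); a general position set covering
-- every vertex outside it is terminal.  Such a set is grown greedily, keeping the invariant
-- that adding any single uncovered vertex preserves general position.  The vertex added is an
-- uncovered w which is adjacent to S if possible and minimises ∑_{s ∈ S} d(w,s).  For a later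
-- uncovered u the only possible violation is u strictly between w and some s ∈ S.  As
-- d(w,s) ≤ 3, either d(w,u) = 1, and then u would have been a better choice than w; or
-- d(w,u) = 2 and d(u,s) = 1, and then a neighbour t ∈ S of w puts u between s and t.
module Submission where

open import Defs hiding (sym)
open import Data.Bool using (true)
import Data.Bool as Bool
open import Data.Empty using (⊥-elim)
open import Data.Fin using (Fin; zero; suc; _≟_)
open import Data.Fin.Properties using (any?)
open import Data.Fin.Subset using (Subset; _∈_; _∉_; _⊆_; _∪_; ⁅_⁆; ∣_∣; ⊥)
open import Data.Fin.Subset.Properties
  using (_∈?_; p⊆p∪q; q⊆p∪q; x∈p∪q⁻; x∈⁅x⁆; x∈⁅y⁆⇒x≡y; ∉⊥; ∣p∣≤n; p⊂q⇒∣p∣<∣q∣)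
open import Data.List.Membership.Propositional using () renaming (_∈_ to _∈ˡ_)
open import Data.List.Relation.Unary.Any using (here; there)
open import Data.Nat using (ℕ; zero; suc; _+_; _*_; _≤_; _<_; z≤n; s≤s; s≤s⁻¹; _<?_)
import Data.Nat as ℕ
open import Data.Nat.Induction using (<-wellFounded)
open import Data.Nat.Properties hiding (_≟_)
open import Algebra.Properties.Monoid.Sum +-0-monoid using (sum)
open import Data.Product using (Σ; _×_; ∃-syntax; _,_; proj₁; proj₂)
open import Data.Sum using (_⊎_; inj₁; inj₂)
import Data.Sum as Sum
open import Function using (_∘_)
open import Function.Metric.Nat using (DistanceFunction; IsMetric)
open import Induction.WellFounded using (Acc; acc)
open import Relation.Nullary using (¬_; Dec; yes; no; ¬?; contradiction)
open import Relation.Nullary.Decidable using (_×-dec_; decidable-stable)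
open import Relation.Unary using (Decidable)
open import Relation.Binary.PropositionalEquality
  using (_≡_; _≢_; refl; sym; trans; cong; cong₂; subst; subst₂; ≢-sym; isEquivalence)
open import Relation.Binary.PropositionalEquality.Properties using (module ≡-Reasoning)

least : ∀ {P : ℕ → Set} → Decidable P → ∀ {m} → P m → ∃[ k ] (P k × ∀ j → P j → k ≤ j)
least {P} P? = go (<-wellFounded _)
  where
  go : ∀ {m} → Acc _<_ m → P m → ∃[ k ] (P k × ∀ j → P j → k ≤ j)
  go {m} (acc below) pm with anyUpTo? P? m
  ... | yes (j , j<m , pj) = go (below j<m) pj
  ... | no none = m , pm , λ j pj → ≮⇒≥ (λ j<m → none (j , j<m , pj))

argmin : ∀ {n} {P : Fin n → Set} → Decidable P → (f : Fin n → ℕ) →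
         ∀ {w} → P w → ∃[ v ] (P v × ∀ {u} → P u → f v ≤ f u)
argmin {P = P} P? f = go (<-wellFounded _)
  where
  go : ∀ {w} → Acc _<_ (f w) → P w → ∃[ v ] (P v × ∀ {u} → P u → f v ≤ f u)
  go {w} (acc below) pw with any? (λ u → P? u ×-dec (f u <? f w))
  ... | yes (u , pu , fu<fw) = go (below fu<fw) pu
  ... | no none = w , pw , λ {u} pu → ≮⇒≥ (λ fu<fw → none (u , pu , fu<fw))

sum-mono-≤ : ∀ {m} (f g : Fin m → ℕ) → (∀ i → f i ≤ g i) → sum f ≤ sum g
sum-mono-≤ {zero}  f g f≤g = z≤n
sum-mono-≤ {suc m} f g f≤g = +-mono-≤ (f≤g zero) (sum-mono-≤ (f ∘ suc) (g ∘ suc) (f≤g ∘ suc))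

sum-mono-< : ∀ {m} (f g : Fin m → ℕ) → (∀ i → f i ≤ g i) → ∀ j → f j < g j → sum f < sum g
sum-mono-< f g f≤g zero    fj<gj = +-mono-<-≤ fj<gj (sum-mono-≤ (f ∘ suc) (g ∘ suc) (f≤g ∘ suc))
sum-mono-< f g f≤g (suc j) fj<gj =
  +-mono-≤-< (f≤g zero) (sum-mono-< (f ∘ suc) (g ∘ suc) (f≤g ∘ suc) j fj<gj)

sum-≤-* : ∀ {m c} (f : Fin m → ℕ) → (∀ i → f i ≤ c) → sum f ≤ m * c
sum-≤-* {zero}  f f≤c = z≤n
sum-≤-* {suc m} f f≤c = +-mono-≤ (f≤c zero) (sum-≤-* (f ∘ suc) (f≤c ∘ suc))

two-or-three : ∀ {a} → 2 ≤ a → a ≤ 3 → a ≡ 2 ⊎ a ≡ 3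
two-or-three {1} (s≤s ()) _
two-or-three {2} _ _ = inj₁ refl
two-or-three {3} _ _ = inj₂ refl
two-or-three {suc (suc (suc (suc _)))} _ (s≤s (s≤s (s≤s ())))

positive-sum-≤3 : ∀ {a b} → a + b ≤ 3 → 0 < a → 0 < b → a ≡ 1 ⊎ (a ≡ 2 × b ≡ 1)
positive-sum-≤3 {1} _ _ _ = inj₁ refl
positive-sum-≤3 {2} {1} _ _ _ = inj₂ (refl , refl)
positive-sum-≤3 {2} {suc (suc _)} (s≤s (s≤s (s≤s ()))) _ _
positive-sum-≤3 {suc (suc (suc a))} {suc b} (s≤s (s≤s (s≤s a+1+b≤0))) _ _ =
  contradiction (n≤0⇒n≡0 a+1+b≤0) (m+1+n≢0 a)

∈-∪-⁅⁆ : ∀ {n} {S : Subset n} {w x} → x ∈ S ∪ ⁅ w ⁆ → x ∈ S ⊎ x ≡ w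
∈-∪-⁅⁆ {S = S} {w} x∈ = Sum.map₂ (x∈⁅y⁆⇒x≡y w) (x∈p∪q⁻ S ⁅ w ⁆ x∈)

∉∈⇒≢ : ∀ {n} {S : Subset n} {x y} → x ∉ S → y ∈ S → x ≢ y
∉∈⇒≢ x∉S y∈S refl = x∉S y∈S

∣p∣<∣p∪⁅x⁆∣ : ∀ {n} {S : Subset n} {x} → x ∉ S → ∣ S ∣ < ∣ S ∪ ⁅ x ⁆ ∣
∣p∣<∣p∪⁅x⁆∣ {S = S} {x} x∉S = p⊂q⇒∣p∣<∣q∣ (p⊆p∪q ⁅ x ⁆ , x , q⊆p∪q S ⁅ x ⁆ (x∈⁅x⁆ x) , x∉S)

module Betweenness {n} {d : DistanceFunction (Fin n)} (isMetric : IsMetric _≡_ d) where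
  open IsMetric isMetric using (triangle; 0⇒≈) renaming (sym to d-sym)

  d-pos : ∀ {x y} → x ≢ y → 0 < d x y
  d-pos x≢y = n≢0⇒n>0 (x≢y ∘ 0⇒≈)

  Between : Fin n → Fin n → Fin n → Set
  Between x y z = d x z ≡ d x y + d y z

  Between-reverse : ∀ {x y z} → Between x y z → Between z y x
  Between-reverse {x} {y} {z} xyz = begin
    d z x         ≡⟨ d-sym z x ⟩
    d x z         ≡⟨ xyz ⟩
    d x y + d y z ≡⟨ +-comm (d x y) (d y z) ⟩
    d y z + d x y ≡⟨ cong₂ _+_ (d-sym y z) (d-sym x y) ⟩
    d z y + d y x ∎
    where open ≡-Reasoning

  Between-dropˡ : ∀ {u a b c} → Between u a b → Between u b c → Between a b c
  Between-dropˡ {u} {a} {b} {c} uab ubc = ≤-antisym (triangle a b c) (+-cancelˡ-≤ (d u a) _ _ (begin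
    d u a + (d a b + d b c) ≡⟨ +-assoc (d u a) (d a b) (d b c) ⟨
    d u a + d a b + d b c   ≡⟨ cong (_+ d b c) uab ⟨
    d u b + d b c           ≡⟨ ubc ⟨
    d u c                   ≤⟨ triangle u a c ⟩
    d u a + d a c           ∎))
    where open ≤-Reasoning

  Between-dropʳ : ∀ {u x y v} → Between u x v → Between x y v → Between u x y
  Between-dropʳ uxv xyv = Between-reverse (Between-dropˡ (Between-reverse xyv) (Between-reverse uxv))

  InGeneralPosition : Subset n → Set
  InGeneralPosition S = ∀ {x y z} → x ∈ S → y ∈ S → z ∈ S → x ≢ y → x ≢ z → y ≢ z → ¬ Between x y z

  Covered : Subset n → Fin n → Set
  Covered S w = ∃[ a ] ∃[ b ] (a ∈ S × b ∈ S × a ≢ b × Between w a b)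

  covered? : ∀ S w → Dec (Covered S w)
  covered? S w = any? λ a → any? λ b →
    (a ∈? S) ×-dec (b ∈? S) ×-dec ¬? (a ≟ b) ×-dec (d w b ℕ.≟ d w a + d a b)

  Covered-mono : ∀ {S T w} → S ⊆ T → Covered S w → Covered T w
  Covered-mono S⊆T (a , b , a∈ , b∈ , a≢b , wab) = a , b , S⊆T a∈ , S⊆T b∈ , a≢b , wab

  InGeneralPosition-∅ : InGeneralPosition ⊥
  InGeneralPosition-∅ x∈ = contradiction x∈ ∉⊥

  InGeneralPosition-insert : ∀ {T u} → InGeneralPosition T → ¬ Covered T u →
                             (∀ {a b} → a ∈ T → b ∈ T → a ≢ b → ¬ Between a u b) →
                             InGeneralPosition (T ∪ ⁅ u ⁆)
  InGeneralPosition-insert gp ¬cov ¬mid x∈ y∈ z∈ x≢y x≢z y≢z xyz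
    with ∈-∪-⁅⁆ x∈ | ∈-∪-⁅⁆ y∈ | ∈-∪-⁅⁆ z∈
  ... | inj₁ x∈T | inj₁ y∈T | inj₁ z∈T = gp x∈T y∈T z∈T x≢y x≢z y≢z xyz
  ... | inj₂ refl | inj₁ y∈T | inj₁ z∈T = ¬cov (_ , _ , y∈T , z∈T , y≢z , xyz)
  ... | inj₁ x∈T | inj₂ refl | inj₁ z∈T = ¬mid x∈T z∈T x≢z xyz
  ... | inj₁ x∈T | inj₁ y∈T | inj₂ refl = ¬cov (_ , _ , y∈T , x∈T , ≢-sym x≢y , Between-reverse xyz)
  ... | inj₂ refl | inj₂ refl | _ = x≢y refl
  ... | inj₂ refl | _ | inj₂ refl = x≢z refl
  ... | _ | inj₂ refl | inj₂ refl = y≢z refl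

  Uncovered : Subset n → Fin n → Set
  Uncovered S w = w ∉ S × ¬ Covered S w

  uncovered? : ∀ S w → Dec (Uncovered S w)
  uncovered? S w = ¬? (w ∈? S) ×-dec ¬? (covered? S w)

  Extendable : Subset n → Set
  Extendable S = ∀ {w} → Uncovered S w → InGeneralPosition (S ∪ ⁅ w ⁆)

  Extendable-∅ : Extendable ⊥
  Extendable-∅ (_ , ¬cov) =
    InGeneralPosition-insert InGeneralPosition-∅ ¬cov (λ a∈ → contradiction a∈ ∉⊥)

module DiameterThree {n} {d : DistanceFunction (Fin n)} (isMetric : IsMetric _≡_ d)
                     (d≤3 : ∀ x y → d x y ≤ 3) where
  open IsMetric isMetric using (triangle) renaming (sym to d-sym)
  open Betweenness isMetric

  Adjacent : Subset n → Fin n → Set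
  Adjacent S w = ∃[ t ] (t ∈ S × d w t ≡ 1)

  adjacent? : ∀ S w → Dec (Adjacent S w)
  adjacent? S w = any? λ t → (t ∈? S) ×-dec (d w t ℕ.≟ 1)

  d-to : Subset n → Fin n → Fin n → ℕ
  d-to S w i with i ∈? S
  ... | yes _ = d w i
  ... | no  _ = 0

  -- The penalty exceeds every ∑ d-to S w, so cost orders first by adjacency to S, then by the sum.
  penalty : ∀ {A : Set} → Dec A → ℕ
  penalty (yes _) = 0
  penalty (no  _) = suc (n * 3)

  cost : Subset n → Fin n → ℕ
  cost S w = penalty (adjacent? S w) + sum (d-to S w)

  d-to-≤3 : ∀ S w i → d-to S w i ≤ 3
  d-to-≤3 S w i with i ∈? S
  ... | yes _ = d≤3 w i
  ... | no  _ = z≤n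

  d-to-mono : ∀ {S u w} → (∀ {i} → i ∈ S → d u i ≤ d w i) → ∀ i → d-to S u i ≤ d-to S w i
  d-to-mono {S} closer i with i ∈? S
  ... | yes i∈S = closer i∈S
  ... | no  _   = z≤n

  d-to-< : ∀ {S u w s} → s ∈ S → d u s < d w s → d-to S u s < d-to S w s
  d-to-< {S} {s = s} s∈S lt with s ∈? S
  ... | yes _   = lt
  ... | no  s∉S = contradiction s∈S s∉S

  penalty-< : ∀ {A B : Set} (a? : Dec A) (b? : Dec B) → (B → A) →
              ∀ {x y} → x < y → penalty a? + x < penalty b? + y
  penalty-< (yes _) (yes _) _    x<y = x<y
  penalty-< (yes _) (no  _) _    x<y = <-≤-trans x<y (m≤n+m _ (suc (n * 3)))
  penalty-< (no ¬a) (yes b) b⇒a  _   = contradiction (b⇒a b) ¬a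
  penalty-< (no  _) (no  _) _    x<y = +-monoʳ-< (suc (n * 3)) x<y

  penalty-≤ : ∀ {A B : Set} (a? : Dec A) (b? : Dec B) → A →
              ∀ {x y} → y ≤ n * 3 → penalty b? + x ≤ penalty a? + y → B
  penalty-≤ _       (yes b) _ _    _  = b
  penalty-≤ (yes _) (no  _) _ y≤3n le = contradiction (≤-trans (m≤m+n _ _) le) (<⇒≱ (s≤s y≤3n))
  penalty-≤ (no ¬a) (no  _) a _    _  = contradiction a ¬a

  cost-< : ∀ {S u w s} → (∀ {i} → i ∈ S → d u i ≤ d w i) → s ∈ S → d u s < d w s →
           (Adjacent S w → Adjacent S u) → cost S u < cost S w
  cost-< {S} {u} {w} {s} closer s∈S us<ws adj⇒adj =
    penalty-< (adjacent? S u) (adjacent? S w) adj⇒adj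
              (sum-mono-< (d-to S u) (d-to S w) (d-to-mono closer) s (d-to-< s∈S us<ws))

  cost-≤⇒Adjacent : ∀ {S u w} → cost S w ≤ cost S u → Adjacent S u → Adjacent S w
  cost-≤⇒Adjacent {S} {u} {w} w≤u a =
    penalty-≤ (adjacent? S u) (adjacent? S w) a (sum-≤-* (d-to S u) (d-to-≤3 S u)) w≤u

  2≤d-beside-neighbour : ∀ {x y z} → d x z ≡ 3 → d x y ≡ 1 → 2 ≤ d y z
  2≤d-beside-neighbour {x} {y} {z} xz≡3 xy≡1 =
    s≤s⁻¹ (subst₂ _≤_ xz≡3 (cong (_+ d y z) xy≡1) (triangle x y z))

  module Insert {S w u} (ext : Extendable S) (w∉S : w ∉ S) (¬cov-w : ¬ Covered S w)
                (w-minimal : cost S w ≤ cost S u)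
                (u∉T : u ∉ S ∪ ⁅ w ⁆) (¬cov-u : ¬ Covered (S ∪ ⁅ w ⁆) u) where

    w∈T : w ∈ S ∪ ⁅ w ⁆
    w∈T = q⊆p∪q S ⁅ w ⁆ (x∈⁅x⁆ w)

    S⊆T : S ⊆ S ∪ ⁅ w ⁆
    S⊆T = p⊆p∪q ⁅ w ⁆

    u∉S : u ∉ S
    u∉S = u∉T ∘ S⊆T

    u-uncovered : Uncovered S u
    u-uncovered = u∉S , ¬cov-u ∘ Covered-mono S⊆T

    gp-S-u : InGeneralPosition (S ∪ ⁅ u ⁆)
    gp-S-u = ext u-uncovered

    u∈S∪u : u ∈ S ∪ ⁅ u ⁆
    u∈S∪u = q⊆p∪q S ⁅ u ⁆ (x∈⁅x⁆ u)

    ¬Between-u-w-S : ∀ {i} → i ∈ S → ¬ Between u w i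
    ¬Between-u-w-S i∈S uwi = ¬cov-u (_ , _ , w∈T , S⊆T i∈S , ∉∈⇒≢ w∉S i∈S , uwi)

    ¬Between-w-u-S-near : ∀ {s} → s ∈ S → d w u ≡ 1 → ¬ Between w u s
    ¬Between-w-u-S-near {s} s∈S wu≡1 wus = <⇒≱ (cost-< closer s∈S us<ws adj⇒adj) w-minimal
      where
      uw≡1 : d u w ≡ 1
      uw≡1 = trans (d-sym u w) wu≡1
      closer : ∀ {i} → i ∈ S → d u i ≤ d w i
      closer {i} i∈S = s≤s⁻¹ (≤∧≢⇒< (subst (λ a → d u i ≤ a + d w i) uw≡1 (triangle u w i))
        λ ui≡1+wi → ¬Between-u-w-S i∈S (trans ui≡1+wi (cong (_+ d w i) (sym uw≡1))))
      us<ws : d u s < d w s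
      us<ws = ≤-reflexive (sym (trans wus (cong (_+ d u s) wu≡1)))
      adj⇒adj : Adjacent S w → Adjacent S u
      adj⇒adj (t , t∈S , wt≡1) =
        t , t∈S , ≤-antisym (subst (d u t ≤_) wt≡1 (closer t∈S)) (d-pos (∉∈⇒≢ u∉S t∈S))

    ¬Between-w-u-S-far : ∀ {s} → s ∈ S → d w u ≡ 2 → d u s ≡ 1 → ¬ Between w u s
    ¬Between-w-u-S-far {s} s∈S wu≡2 us≡1 wus with cost-≤⇒Adjacent w-minimal (s , s∈S , us≡1)
    ... | t , t∈S , wt≡1 = gp-S-u (S⊆S∪u s∈S) u∈S∪u (S⊆S∪u t∈S) (≢-sym u≢s) s≢t u≢t sut
      where
      S⊆S∪u : S ⊆ S ∪ ⁅ u ⁆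
      S⊆S∪u = p⊆p∪q ⁅ u ⁆
      u≢s : u ≢ s
      u≢s = ∉∈⇒≢ u∉S s∈S
      u≢t : u ≢ t
      u≢t = ∉∈⇒≢ u∉S t∈S
      ws≡3 : d w s ≡ 3
      ws≡3 = trans wus (cong₂ _+_ wu≡2 us≡1)
      s≢t : s ≢ t
      s≢t refl = contradiction (trans (sym wt≡1) ws≡3) λ ()
      ts≡3 : d t s ≡ 3
      ts≡3 with two-or-three (2≤d-beside-neighbour ws≡3 wt≡1) (d≤3 t s)
      ... | inj₂ ts≡3 = ts≡3
      ... | inj₁ ts≡2 =
        contradiction (t , s , t∈S , s∈S , ≢-sym s≢t , trans ws≡3 (sym (cong₂ _+_ wt≡1 ts≡2))) ¬cov-w
      st≡3 : d s t ≡ 3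
      st≡3 = trans (d-sym s t) ts≡3
      su≡1 : d s u ≡ 1
      su≡1 = trans (d-sym s u) us≡1
      ut≡2 : d u t ≡ 2
      ut≡2 with two-or-three (2≤d-beside-neighbour st≡3 su≡1) (d≤3 u t)
      ... | inj₁ ut≡2 = ut≡2
      ... | inj₂ ut≡3 =
        contradiction (trans ut≡3 (sym (cong₂ _+_ (trans (d-sym u w) wu≡2) wt≡1))) (¬Between-u-w-S t∈S)
      sut : Between s u t
      sut = trans st≡3 (sym (cong₂ _+_ su≡1 ut≡2))

    ¬Between-w-u-S : ∀ {s} → s ∈ S → ¬ Between w u s
    ¬Between-w-u-S {s} s∈S wus
      with positive-sum-≤3 (subst (_≤ 3) wus (d≤3 w s))
                           (d-pos (≢-sym (∉∈⇒≢ u∉T w∈T))) (d-pos (∉∈⇒≢ u∉S s∈S))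
    ... | inj₁ wu≡1           = ¬Between-w-u-S-near s∈S wu≡1 wus
    ... | inj₂ (wu≡2 , us≡1) = ¬Between-w-u-S-far s∈S wu≡2 us≡1 wus

    ¬Between-T-u-T : ∀ {a b} → a ∈ S ∪ ⁅ w ⁆ → b ∈ S ∪ ⁅ w ⁆ → a ≢ b → ¬ Between a u b
    ¬Between-T-u-T a∈ b∈ a≢b aub with ∈-∪-⁅⁆ a∈ | ∈-∪-⁅⁆ b∈
    ... | inj₁ a∈S | inj₁ b∈S = gp-S-u (p⊆p∪q ⁅ u ⁆ a∈S) u∈S∪u (p⊆p∪q ⁅ u ⁆ b∈S)
                                  (≢-sym (∉∈⇒≢ u∉S a∈S)) a≢b (∉∈⇒≢ u∉S b∈S) aub
    ... | inj₂ refl | inj₁ b∈S = ¬Between-w-u-S b∈S aub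
    ... | inj₁ a∈S | inj₂ refl = ¬Between-w-u-S a∈S (Between-reverse aub)
    ... | inj₂ refl | inj₂ refl = a≢b refl

    gp-T-u : InGeneralPosition ((S ∪ ⁅ w ⁆) ∪ ⁅ u ⁆)
    gp-T-u = InGeneralPosition-insert (ext (w∉S , ¬cov-w)) ¬cov-u ¬Between-T-u-T

  Extendable-insert : ∀ {S w} → Extendable S → Uncovered S w →
                      (∀ {u} → Uncovered S u → cost S w ≤ cost S u) → Extendable (S ∪ ⁅ w ⁆)
  Extendable-insert ext (w∉S , ¬cov-w) w-minimal (u∉T , ¬cov-u) =
    Insert.gp-T-u ext w∉S ¬cov-w (w-minimal (u∉T ∘ p⊆p∪q _ , ¬cov-u ∘ Covered-mono (p⊆p∪q _)))
                  u∉T ¬cov-u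

  cheapest-uncovered : ∀ S → (∀ {w} → w ∉ S → Covered S w) ⊎
                       ∃[ w ] (Uncovered S w × ∀ {u} → Uncovered S u → cost S w ≤ cost S u)
  cheapest-uncovered S with any? (uncovered? S)
  ... | yes (w , unc) = inj₂ (argmin (uncovered? S) (cost S) unc)
  ... | no  none      =
    inj₁ λ {w} w∉S → decidable-stable (covered? S w) (λ ¬cov → none (w , w∉S , ¬cov))

  grow : ∀ k {S} → InGeneralPosition S → Extendable S → n ≤ k + ∣ S ∣ →
         ∃[ T ] (InGeneralPosition T × ∀ {w} → w ∉ T → Covered T w)
  grow k {S} gp ext n≤k+∣S∣ with cheapest-uncovered S
  ... | inj₁ all-covered = S , gp , all-covered
  grow zero {S} gp ext n≤∣S∣ | inj₂ (w , (w∉S , _) , _) =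
    ⊥-elim (<-irrefl refl (≤-trans (∣p∣<∣p∪⁅x⁆∣ w∉S) (≤-trans (∣p∣≤n (S ∪ ⁅ w ⁆)) n≤∣S∣)))
  grow (suc k) {S} gp ext n≤1+k+∣S∣ | inj₂ (w , w-unc@(w∉S , _) , w-minimal) =
    grow k (ext w-unc) (Extendable-insert ext w-unc w-minimal)
         (≤-trans n≤1+k+∣S∣ (≤-trans (≤-reflexive (sym (+-suc k ∣ S ∣)))
                                     (+-monoʳ-≤ k (∣p∣<∣p∪⁅x⁆∣ w∉S))))

  covering-general-position-set : ∃[ S ] (InGeneralPosition S × ∀ {w} → w ∉ S → Covered S w)
  covering-general-position-set = grow n InGeneralPosition-∅ Extendable-∅ (m≤m+n n _)

module GraphMetric {n} (G : Graph n) where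

  _++ʷ_ : ∀ {u v w i j} → Walk G u v i → Walk G v w j → Walk G u w (i + j)
  nil      ++ʷ q = q
  cons e p ++ʷ q = cons e (p ++ʷ q)

  snocʷ : ∀ {u v w k} → Walk G u v k → adj G v w ≡ true → Walk G u w (suc k)
  snocʷ nil        e = cons e nil
  snocʷ (cons e p) e′ = cons e (snocʷ p e′)

  reverseʷ : ∀ {u v k} → Walk G u v k → Walk G v u k
  reverseʷ nil                = nil
  reverseʷ (cons {u} {w} e p) = snocʷ (reverseʷ p) (trans (Graph.sym G w u) e)

  nil-endpoints : ∀ {u v} → Walk G u v 0 → u ≡ v
  nil-endpoints nil = refl

  head∈verts : ∀ {u v k} (p : Walk G u v k) → u ∈ˡ verts G p
  head∈verts nil        = here refl
  head∈verts (cons _ _) = here refl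

  last∈verts : ∀ {u v k} (p : Walk G u v k) → v ∈ˡ verts G p
  last∈verts nil        = here refl
  last∈verts (cons _ p) = there (last∈verts p)

  ∈-verts-++ʳ : ∀ {u v w i j y} (p : Walk G u v i) (q : Walk G v w j) →
                y ∈ˡ verts G q → y ∈ˡ verts G (p ++ʷ q)
  ∈-verts-++ʳ nil        q y∈q = y∈q
  ∈-verts-++ʳ (cons _ p) q y∈q = there (∈-verts-++ʳ p q y∈q)

  walk? : ∀ k u v → Dec (Walk G u v k)
  walk? zero u v with u ≟ v
  ... | yes refl = yes nil
  ... | no  u≢v  = no λ { nil → u≢v refl }
  walk? (suc k) u v with any? (λ w → (adj G u w Bool.≟ true) ×-dec walk? k w v)
  ... | yes (w , e , p) = yes (cons e p)
  ... | no  none        = no λ { (cons e p) → none (_ , e , p) }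

  record Split {u v k} (p : Walk G u v k) (x : Fin n) : Set where
    field
      i j    : ℕ
      prefix : Walk G u x i
      suffix : Walk G x v j
      length : i + j ≡ k
      cover  : ∀ {y} → y ∈ˡ verts G p → y ∈ˡ verts G prefix ⊎ y ∈ˡ verts G suffix

  splitAt : ∀ {u v k x} (p : Walk G u v k) → x ∈ˡ verts G p → Split p x
  splitAt nil (here refl) =
    record { i = 0 ; j = 0 ; prefix = nil ; suffix = nil ; length = refl ; cover = inj₁ }
  splitAt p@(cons _ _) (here refl) =
    record { i = 0 ; j = _ ; prefix = nil ; suffix = p ; length = refl ; cover = inj₂ }
  splitAt (cons e p) (there x∈p) = record
    { i = suc i ; j = j ; prefix = cons e prefix ; suffix = suffix ; length = cong suc length
    ; cover = λ { (here refl) → inj₁ (here refl) ; (there y∈p) → Sum.map₁ there (cover y∈p) } }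
    where open Split (splitAt p x∈p)

  module _ {u v k x} {p : Walk G u v k} (sp : IsShortest G p) (s : Split p x) where
    open Split s

    prefix-shortest : IsShortest G prefix
    prefix-shortest i′ q = +-cancelʳ-≤ j i i′ (subst (_≤ i′ + j) (sym length) (sp _ (q ++ʷ suffix)))

    suffix-shortest : IsShortest G suffix
    suffix-shortest j′ q = +-cancelˡ-≤ i j j′ (subst (_≤ i + j′) (sym length) (sp _ (prefix ++ʷ q)))

  module Distance (connected : ∀ u v → ∃[ k ] Walk G u v k) where

    distance : ∀ u v → ∃[ k ] Dist G u v k
    distance u v = least (λ k → walk? k u v) (proj₂ (connected u v))

    d : DistanceFunction (Fin n)
    d u v = proj₁ (distance u v)

    walk-d : ∀ u v → Walk G u v (d u v)
    walk-d u v = proj₁ (proj₂ (distance u v))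

    walk-d-shortest : ∀ u v → IsShortest G (walk-d u v)
    walk-d-shortest u v = proj₂ (proj₂ (distance u v))

    d-isMetric : IsMetric _≡_ d
    d-isMetric = record
      { isSemiMetric = record
        { isQuasiSemiMetric = record
          { isPreMetric = record
            { isProtoMetric = record
              { isPartialOrder  = ≤-isPartialOrder
              ; ≈-isEquivalence = isEquivalence
              ; cong            = cong₂ d
              ; nonNegative     = z≤n
              }
            ; ≈⇒0 = λ { {x} refl → n≤0⇒n≡0 (walk-d-shortest x x 0 nil) }
            }
          ; 0⇒≈ = λ {x} {y} d≡0 → nil-endpoints (subst (Walk G x y) d≡0 (walk-d x y))
          }
        ; sym = λ x y → ≤-antisym (walk-d-shortest x y _ (reverseʷ (walk-d y x)))
                                  (walk-d-shortest y x _ (reverseʷ (walk-d x y)))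
        }
      ; triangle = λ x y z → walk-d-shortest x z _ (walk-d x y ++ʷ walk-d y z)
      }

    open Betweenness d-isMetric

    shortest-length : ∀ {u v k} (p : Walk G u v k) → IsShortest G p → k ≡ d u v
    shortest-length {u} {v} p sp = ≤-antisym (sp _ (walk-d u v)) (walk-d-shortest u v _ p)

    shortest-Between : ∀ {u v k x} {p : Walk G u v k} → IsShortest G p → x ∈ˡ verts G p →
                       Between u x v
    shortest-Between {u} {v} {k} {x} {p} sp x∈p = begin
      d u v         ≡⟨ shortest-length p sp ⟨
      k             ≡⟨ length ⟨
      i + j         ≡⟨ cong₂ _+_ (shortest-length prefix (prefix-shortest sp s))
                                  (shortest-length suffix (suffix-shortest sp s)) ⟩
      d u x + d x v ∎
      where
      s : Split p x
      s = splitAt p x∈p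
      open Split s
      open ≡-Reasoning

    shortest-ordered : ∀ {u v k x y} {p : Walk G u v k} → IsShortest G p →
                       x ∈ˡ verts G p → y ∈ˡ verts G p → Between u x y ⊎ Between u y x
    shortest-ordered {u} {v} {x = x} {y} {p} sp x∈p y∈p = ordered (splitAt p x∈p)
      where
      ordered : Split p x → Between u x y ⊎ Between u y x
      ordered s with Split.cover s y∈p
      ... | inj₁ y∈prefix = inj₂ (shortest-Between (prefix-shortest sp s) y∈prefix)
      ... | inj₂ y∈suffix =
        inj₁ (Between-dropʳ (shortest-Between sp x∈p) (shortest-Between (suffix-shortest sp s) y∈suffix))

    InGeneralPosition⇒GeneralPosition : ∀ {S} → InGeneralPosition S → GeneralPosition G S
    InGeneralPosition⇒GeneralPosition gp u v k p sp
                                      (x , y , z , x≢y , x≢z , y≢z , x∈ , y∈ , z∈ , x∈p , y∈p , z∈p)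
      with shortest-ordered sp x∈p y∈p | shortest-ordered sp y∈p z∈p | shortest-ordered sp x∈p z∈p
    ... | inj₁ uxy | inj₁ uyz | _        = gp x∈ y∈ z∈ x≢y x≢z y≢z (Between-dropˡ uxy uyz)
    ... | inj₂ uyx | inj₂ uzy | _        = gp z∈ y∈ x∈ (≢-sym y≢z) (≢-sym x≢z) (≢-sym x≢y) (Between-dropˡ uzy uyx)
    ... | inj₁ uxy | inj₂ uzy | inj₁ uxz = gp x∈ z∈ y∈ x≢z x≢y (≢-sym y≢z) (Between-dropˡ uxz uzy)
    ... | inj₁ uxy | inj₂ uzy | inj₂ uzx = gp z∈ x∈ y∈ (≢-sym x≢z) (≢-sym y≢z) x≢y (Between-dropˡ uzx uxy)
    ... | inj₂ uyx | inj₁ uyz | inj₁ uxz = gp y∈ x∈ z∈ (≢-sym x≢y) y≢z x≢z (Between-dropˡ uyx uxz)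
    ... | inj₂ uyx | inj₁ uyz | inj₂ uzx = gp y∈ z∈ x∈ y≢z (≢-sym x≢y) (≢-sym x≢z) (Between-dropˡ uyz uzx)

    Covered⇒shortest-walk : ∀ {S w} → Covered S w →
                            ∃[ v ] ∃[ k ] Σ (Walk G w v k) λ p → IsShortest G p × Contains2 G S p
    Covered⇒shortest-walk {w = w} (a , b , a∈ , b∈ , a≢b , wab) =
      b , _ , p , sp , a , b , a≢b , a∈ , b∈
        , ∈-verts-++ʳ (walk-d w a) (walk-d a b) (head∈verts (walk-d a b))
        , ∈-verts-++ʳ (walk-d w a) (walk-d a b) (last∈verts (walk-d a b))
      where
      p : Walk G w b (d w a + d a b)
      p = walk-d w a ++ʷ walk-d a b
      sp : IsShortest G p
      sp k q = subst (_≤ k) wab (walk-d-shortest w b k q)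

    covering⇒IsTerminal : ∀ {S} → InGeneralPosition S → (∀ {w} → w ∉ S → Covered S w) →
                          IsTerminal G S
    covering⇒IsTerminal {S} gp covering = (InGeneralPosition⇒GeneralPosition gp , maximal) , λ u u∉S →
      let (v , k , walk) = Covered⇒shortest-walk (covering u∉S) in v , k , inj₁ walk
      where
      maximal : ∀ T → GeneralPosition G T → S ⊆ T → T ⊆ S
      maximal T gpT S⊆T {t} t∈T with t ∈? S
      ... | yes t∈S = t∈S
      ... | no  t∉S with Covered⇒shortest-walk (covering t∉S)
      ...   | _ , _ , p , sp , a , b , a≢b , a∈ , b∈ , a∈p , b∈p =
        ⊥-elim (gpT _ _ _ p sp (t , a , b , ∉∈⇒≢ t∉S a∈ , ∉∈⇒≢ t∉S b∈ , a≢b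
                       , t∈T , S⊆T a∈ , S⊆T b∈ , head∈verts p , a∈p , b∈p))

theorem3p2 : ∀ (n : ℕ) (G : Graph n) → HasDiameter G 3 → ∃[ S ] IsTerminal G S
theorem3p2 n G (within3 , _) =
  let (S , gp , covering) = covering-general-position-set in S , covering⇒IsTerminal gp covering
  where
  open GraphMetric G

  connected : ∀ u v → ∃[ k ] Walk G u v k
  connected u v = let (k , _ , p) = within3 u v in k , p

  open Distance connected

  d≤3 : ∀ u v → d u v ≤ 3
  d≤3 u v = let (k , k≤3 , p) = within3 u v in ≤-trans (walk-d-shortest u v k p) k≤3

  open DiameterThree d-isMetric d≤3 using (covering-general-position-set)
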